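{- For any integers $k \geq 2$, $\beta \geq 0$ and $\alpha > 0$, $$C_{k,(\alpha,\beta)}(t,z) = C_{k,(\alpha-1,\beta-1)}(t) + \sum_{i \geq 1} z^i t^i C_{k,(\alpha-1,k-2)}(t) \, C_k(t)^{\beta + (i-1)(k-1)}.$$
   Context: For an integer $k\ge 2$ and integers $\alpha,\beta, n\ge 0$, let $\mathcal{D}^k_{n,(\alpha,\beta)}$ be the set of integer lattice paths from $(0,\alpha)$ to $(kn+\beta-\alpha,\beta)$ using steps $U=(1,1)$ and $D=(1,1-k)$ that stay weakly above the line $y=0$ (such paths have exactly $n$ steps $D$; the empty path is included when $n=0$, $\alpha=\beta$), $C^k_{n,(\alpha,\beta)}=|\mathcal{D}^k_{n,(\alpha,\beta)}|$ (set to $0$ if $\alpha<0$ or $\beta<0$), and $C_{k,(\alpha,\beta)}(t)=\sum_{n\ge0}C^k_{n,(\alpha,\beta)}t^n$. A return to ground is a $D$ step whose right endpoint lies on $y=0$. $C^k_{n,(\alpha,\beta),\rho}$ is the number of paths in $\mathcal{D}^k_{n,(\alpha,\beta)}$ with exactly $\rho$ returns to ground, and $C_{k,(\alpha,\beta)}(t,z)=\sum_{n,\rho\ge0}C^k_{n,(\alpha,\beta),\rho}t^nz^\rho$. $C_k(t)=\sum_{n\ge0} \frac{1}{kn+1}\binom{kn+1}{n} t^n$ is the $k$-Catalan generating function. -}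

module Defs where

open import Data.Nat using (ℕ; zero; suc; _+_; _*_; _∸_; _≤ᵇ_; _≡ᵇ_; _/_)
open import Data.Nat.Combinatorics using (_C_)
open import Data.Integer using (ℤ; +_; -[1+_])
open import Data.Bool using (Bool; true; false; if_then_else_; _∧_)
open import Data.List using (List; []; _∷_; concatMap; map)
open import Data.Nat.ListAction using (sum)
open import Data.Maybe using (Maybe; just; nothing)
open import Data.Product using (_×_; _,_)

-- Steps: U = (1,1), D = (1,1-k)
data Step : Set where
  U D : Step

allWords : ℕ → List (List Step)
allWords zero = [] ∷ []
allWords (suc L) = concatMap (λ w → (U ∷ w) ∷ (D ∷ w) ∷ []) (allWords L)

countD : List Step → ℕ
countD [] = 0
countD (U ∷ w) = countD w
countD (D ∷ w) = suc (countD w)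

-- walk k h w : starting at height h, follow w.
-- nothing if the path goes strictly below y = 0;
-- otherwise just (final height , number of returns to ground),
-- a return being a D step whose right endpoint has height 0.
walk : ℕ → ℕ → List Step → Maybe (ℕ × ℕ)
walk k h [] = just (h , 0)
walk k h (U ∷ w) = walk k (suc h) w
walk k h (D ∷ w) with k ≤ᵇ suc h
... | false = nothing
... | true with walk k (suc h ∸ k) w
...   | nothing = nothing
...   | just (h' , r) = just (h' , (if (suc h ∸ k) ≡ᵇ 0 then suc r else r))

pathLen : ℕ → ℕ → ℕ → ℕ → ℕ
pathLen k n α β = k * n + β ∸ α

isPathRet : ℕ → ℕ → ℕ → ℕ → ℕ → List Step → Bool
isPathRet k n α β ρ w with walk k α w
... | nothing = false
... | just (h , r) = (countD w ≡ᵇ n) ∧ ((h ≡ᵇ β) ∧ (r ≡ᵇ ρ))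

isPath : ℕ → ℕ → ℕ → ℕ → List Step → Bool
isPath k n α β w with walk k α w
... | nothing = false
... | just (h , r) = (countD w ≡ᵇ n) ∧ (h ≡ᵇ β)

countIf : (List Step → Bool) → List (List Step) → ℕ
countIf p ws = sum (map (λ w → if p w then 1 else 0) ws)

Cret : ℕ → ℕ → ℕ → ℕ → ℕ → ℕ
Cret k n α β ρ = countIf (isPathRet k n α β ρ) (allWords (pathLen k n α β))

Cnat : ℕ → ℕ → ℕ → ℕ → ℕ
Cnat k n α β = countIf (isPath k n α β) (allWords (pathLen k n α β))

Cint : ℕ → ℕ → ℤ → ℤ → ℕ
Cint k n (+ α) (+ β) = Cnat k n α β
Cint k n (+ α) -[1+ β ] = 0
Cint k n -[1+ α ] b = 0

-- formal power series in t with ℕ coefficients, as coefficient sequences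
Series : Set
Series = ℕ → ℕ

sumTo : ℕ → (ℕ → ℕ) → ℕ
sumTo zero f = f 0
sumTo (suc n) f = sumTo n f + f (suc n)

_⊛_ : Series → Series → Series
(f ⊛ g) n = sumTo n (λ j → f j * g (n ∸ j))

oneS : Series
oneS zero = 1
oneS (suc n) = 0

powS : Series → ℕ → Series
powS f zero = oneS
powS f (suc m) = f ⊛ powS f m

shiftS : ℕ → Series → Series
shiftS i f n = if i ≤ᵇ n then f (n ∸ i) else 0

catalan : ℕ → Series
catalan k n = ((suc (k * n)) C n) / suc (k * n)

CGF : ℕ → ℤ → ℤ → Series
CGF k a b n = Cint k n a b

-- Weight every walk by a function W of its number of returns. A walk from α > 0 either never
-- returns, and then it is a walk from α - 1 to β - 1 lifted by one, or it splits at its first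
-- return into a lifted walk from α - 1 to k - 2, the returning step D, and a walk from the ground
-- with one return less; this is proved by induction on the distance to the target, decomposing by
-- the first step. At the ground the same splitting shows that a walk to β is a walk to 0 followed
-- by a lifted walk to β - 1, so C_{(0,β)} = C_{(0,0)}^(β+1), and that the walks from the ground to
-- β with r returns contribute t^r C_{(0,0)}^(β + r(k-1)). Finally C_{(0,0)} = C_k: decomposing by
-- the last step gives the ballot formula C^k_{n,(0,j)} = binom(kn+j, n) - (k-1) binom(kn+j, n-1),
-- which at j = 0 equals binom(kn+1, n)/(kn+1) by the absorption identity.
module Submission where

open import Defs
open import Data.Bool using (true; false; if_then_else_; _∧_)
open import Data.Bool.Properties using (T-≡; ∧-zeroʳ; ∧-assoc)
import Data.Integer as ℤ
open import Data.List using (List; []; _∷_; map; length; concatMap)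
open import Data.List.Properties using (map-cong)
open import Data.Maybe using (just; nothing)
open import Data.Nat
open import Data.Nat.Combinatorics using (_C_; nCk+nC[k+1]≡[n+1]C[k+1]; nC1≡n; k>n⇒nCk≡0)
open import Data.Nat.DivMod using (m*n/n≡m)
open import Data.Nat.ListAction using (sum)
open import Data.Nat.Properties
open import Data.Nat.Tactic.RingSolver using (solve-∀)
open import Data.Product using (_×_; _,_)
open import Function using (_∘_; const)
open import Function.Bundles using (Equivalence)
open import Relation.Binary.Definitions using (tri<; tri≈; tri>)
open import Relation.Binary.PropositionalEquality
open import Relation.Nullary using (Dec; yes; no; contradiction)
open ≡-Reasoning

sumTo-cong : ∀ n {f g : ℕ → ℕ} → (∀ j → j ≤ n → f j ≡ g j) → sumTo n f ≡ sumTo n g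
sumTo-cong zero    f≡g = f≡g 0 z≤n
sumTo-cong (suc n) f≡g =
  cong₂ _+_ (sumTo-cong n (λ j j≤n → f≡g j (m≤n⇒m≤1+n j≤n))) (f≡g (suc n) ≤-refl)

sumTo-zero : ∀ n {f : ℕ → ℕ} → (∀ j → j ≤ n → f j ≡ 0) → sumTo n f ≡ 0
sumTo-zero zero    f≡0 = f≡0 0 z≤n
sumTo-zero (suc n) f≡0 =
  cong₂ _+_ (sumTo-zero n (λ j j≤n → f≡0 j (m≤n⇒m≤1+n j≤n))) (f≡0 (suc n) ≤-refl)

sumTo-distrib-+ : ∀ n (f g : ℕ → ℕ) → sumTo n (λ j → f j + g j) ≡ sumTo n f + sumTo n g
sumTo-distrib-+ zero    f g = refl
sumTo-distrib-+ (suc n) f g = begin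
  sumTo n (λ j → f j + g j) + (f (suc n) + g (suc n))
    ≡⟨ cong (_+ (f (suc n) + g (suc n))) (sumTo-distrib-+ n f g) ⟩
  sumTo n f + sumTo n g + (f (suc n) + g (suc n))
    ≡⟨ +-comm-middle (sumTo n f) (sumTo n g) (f (suc n)) (g (suc n)) ⟩
  sumTo n f + f (suc n) + (sumTo n g + g (suc n)) ∎
  where
  +-comm-middle : ∀ a b c d → a + b + (c + d) ≡ a + c + (b + d)
  +-comm-middle = solve-∀

*-distribˡ-sumTo : ∀ n c (f : ℕ → ℕ) → sumTo n (λ j → c * f j) ≡ c * sumTo n f
*-distribˡ-sumTo zero    c f = refl
*-distribˡ-sumTo (suc n) c f =
  trans (cong (_+ c * f (suc n)) (*-distribˡ-sumTo n c f)) (sym (*-distribˡ-+ c (sumTo n f) (f (suc n))))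

sumTo-head : ∀ n (f : ℕ → ℕ) → sumTo (suc n) f ≡ f 0 + sumTo n (f ∘ suc)
sumTo-head zero    f = refl
sumTo-head (suc n) f = trans (cong (_+ f (suc (suc n))) (sumTo-head n f)) (+-assoc (f 0) _ _)

sumTo-reverse : ∀ n (f : ℕ → ℕ) → sumTo n f ≡ sumTo n (λ j → f (n ∸ j))
sumTo-reverse zero    f = refl
sumTo-reverse (suc n) f = begin
  sumTo n f + f (suc n)                  ≡⟨ cong (_+ f (suc n)) (sumTo-reverse n f) ⟩
  sumTo n (λ j → f (n ∸ j)) + f (suc n)  ≡⟨ +-comm _ (f (suc n)) ⟩
  f (suc n) + sumTo n (λ j → f (n ∸ j))  ≡⟨ sumTo-head n (λ j → f (suc n ∸ j)) ⟨
  sumTo (suc n) (λ j → f (suc n ∸ j))    ∎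

⊛-suc : ∀ (f g : Series) n → (f ⊛ g) (suc n) ≡ f 0 * g (suc n) + ((f ∘ suc) ⊛ g) n
⊛-suc f g n = sumTo-head n (λ j → f j * g (suc n ∸ j))

⊛-congˡ : ∀ {f f′ : Series} (g : Series) → f ≗ f′ → f ⊛ g ≗ f′ ⊛ g
⊛-congˡ g f≗f′ n = sumTo-cong n (λ j _ → cong (_* g (n ∸ j)) (f≗f′ j))

⊛-congʳ : ∀ (f : Series) {g g′ : Series} → g ≗ g′ → f ⊛ g ≗ f ⊛ g′
⊛-congʳ f g≗g′ n = sumTo-cong n (λ j _ → cong (f j *_) (g≗g′ (n ∸ j)))

⊛-comm : ∀ (f g : Series) → f ⊛ g ≗ g ⊛ f
⊛-comm f g n = begin
  sumTo n (λ j → f j * g (n ∸ j))                ≡⟨ sumTo-reverse n _ ⟩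
  sumTo n (λ j → f (n ∸ j) * g (n ∸ (n ∸ j)))    ≡⟨ sumTo-cong n swap ⟩
  sumTo n (λ j → g j * f (n ∸ j))                ∎
  where
  swap : ∀ j → j ≤ n → f (n ∸ j) * g (n ∸ (n ∸ j)) ≡ g j * f (n ∸ j)
  swap j j≤n = trans (cong (λ i → f (n ∸ j) * g i) (m∸[m∸n]≡n j≤n)) (*-comm (f (n ∸ j)) (g j))

⊛-distribʳ-+ : ∀ (a b h : Series) → (λ j → a j + b j) ⊛ h ≗ λ n → (a ⊛ h) n + (b ⊛ h) n
⊛-distribʳ-+ a b h n = trans (sumTo-cong n (λ j _ → *-distribʳ-+ (h (n ∸ j)) (a j) (b j)))
                             (sumTo-distrib-+ n _ _)

⊛-*ˡ : ∀ c (a h : Series) → (λ j → c * a j) ⊛ h ≗ λ n → c * (a ⊛ h) n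
⊛-*ˡ c a h n = trans (sumTo-cong n (λ j _ → *-assoc c (a j) (h (n ∸ j)))) (*-distribˡ-sumTo n c _)

⊛-assoc : ∀ (f g h : Series) → (f ⊛ g) ⊛ h ≗ f ⊛ (g ⊛ h)
⊛-assoc f g h zero    = *-assoc (f 0) (g 0) (h 0)
⊛-assoc f g h (suc n) = begin
  ((f ⊛ g) ⊛ h) (suc n)
    ≡⟨ ⊛-suc (f ⊛ g) h n ⟩
  f 0 * g 0 * h (suc n) + (((f ⊛ g) ∘ suc) ⊛ h) n
    ≡⟨ cong (f 0 * g 0 * h (suc n) +_) (⊛-congˡ h (⊛-suc f g) n) ⟩
  f 0 * g 0 * h (suc n) + ((λ j → f 0 * g (suc j) + ((f ∘ suc) ⊛ g) j) ⊛ h) n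
    ≡⟨ cong (f 0 * g 0 * h (suc n) +_) (⊛-distribʳ-+ (λ j → f 0 * g (suc j)) ((f ∘ suc) ⊛ g) h n) ⟩
  f 0 * g 0 * h (suc n) + (((λ j → f 0 * g (suc j)) ⊛ h) n + (((f ∘ suc) ⊛ g) ⊛ h) n)
    ≡⟨ cong₂ (λ x y → f 0 * g 0 * h (suc n) + (x + y)) (⊛-*ˡ (f 0) (g ∘ suc) h n) (⊛-assoc (f ∘ suc) g h n) ⟩
  f 0 * g 0 * h (suc n) + (f 0 * ((g ∘ suc) ⊛ h) n + ((f ∘ suc) ⊛ (g ⊛ h)) n)
    ≡⟨ regroup (f 0) (g 0) (h (suc n)) _ _ ⟩
  f 0 * (g 0 * h (suc n) + ((g ∘ suc) ⊛ h) n) + ((f ∘ suc) ⊛ (g ⊛ h)) n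
    ≡⟨ cong (λ x → f 0 * x + ((f ∘ suc) ⊛ (g ⊛ h)) n) (⊛-suc g h n) ⟨
  f 0 * (g ⊛ h) (suc n) + ((f ∘ suc) ⊛ (g ⊛ h)) n
    ≡⟨ ⊛-suc f (g ⊛ h) n ⟨
  (f ⊛ (g ⊛ h)) (suc n) ∎
  where
  regroup : ∀ a b c d e → a * b * c + (a * d + e) ≡ a * (b * c + d) + e
  regroup = solve-∀

⊛-identityˡ : ∀ (g : Series) → oneS ⊛ g ≗ g
⊛-identityˡ g zero    = +-identityʳ (g 0)
⊛-identityˡ g (suc n) = begin
  (oneS ⊛ g) (suc n)                   ≡⟨ ⊛-suc oneS g n ⟩
  g (suc n) + 0 + (const 0 ⊛ g) n      ≡⟨ cong₂ _+_ (+-identityʳ _) (sumTo-zero n (λ _ _ → refl)) ⟩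
  g (suc n) + 0                        ≡⟨ +-identityʳ _ ⟩
  g (suc n)                            ∎

shiftS-⊛ˡ : ∀ (f g : Series) → shiftS 1 f ⊛ g ≗ shiftS 1 (f ⊛ g)
shiftS-⊛ˡ f g zero    = refl
shiftS-⊛ˡ f g (suc n) = ⊛-suc (shiftS 1 f) g n

shiftS-suc : ∀ r (f : Series) → shiftS (suc r) f ≗ shiftS 1 (shiftS r f)
shiftS-suc r       f zero    = refl
shiftS-suc zero    f (suc n) = refl
shiftS-suc (suc r) f (suc n) = refl

shiftS-cong : ∀ r {f g : Series} → f ≗ g → shiftS r f ≗ shiftS r g
shiftS-cong r f≗g n with r ≤ᵇ n
... | true  = f≗g (n ∸ r)
... | false = refl

⊛-shiftSʳ : ∀ r (f g : Series) → f ⊛ shiftS r g ≗ shiftS r (f ⊛ g)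
⊛-shiftSʳ zero    f g n = refl
⊛-shiftSʳ (suc r) f g n = begin
  (f ⊛ shiftS (suc r) g) n          ≡⟨ ⊛-congʳ f (shiftS-suc r g) n ⟩
  (f ⊛ shiftS 1 (shiftS r g)) n     ≡⟨ ⊛-comm f (shiftS 1 (shiftS r g)) n ⟩
  (shiftS 1 (shiftS r g) ⊛ f) n     ≡⟨ shiftS-⊛ˡ (shiftS r g) f n ⟩
  shiftS 1 (shiftS r g ⊛ f) n       ≡⟨ shiftS-cong 1 (λ m → trans (⊛-comm (shiftS r g) f m) (⊛-shiftSʳ r f g m)) n ⟩
  shiftS 1 (shiftS r (f ⊛ g)) n     ≡⟨ shiftS-suc r (f ⊛ g) n ⟨
  shiftS (suc r) (f ⊛ g) n          ∎

powS-cong : ∀ m {f g : Series} → f ≗ g → powS f m ≗ powS g m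
powS-cong zero    f≗g n = refl
powS-cong (suc m) {f} {g} f≗g n = trans (⊛-congˡ (powS f m) f≗g n) (⊛-congʳ g (powS-cong m f≗g) n)

powS-+ : ∀ a b (f : Series) → powS f a ⊛ powS f b ≗ powS f (a + b)
powS-+ zero    b f n = ⊛-identityˡ (powS f b) n
powS-+ (suc a) b f n = trans (⊛-assoc f (powS f a) (powS f b) n) (⊛-congʳ f (powS-+ a b f) n)

shiftS1-+ : ∀ (f g : Series) → shiftS 1 (λ j → f j + g j) ≗ λ n → shiftS 1 f n + shiftS 1 g n
shiftS1-+ f g zero    = refl
shiftS1-+ f g (suc n) = refl

-- The coefficient of t^n in A is determined by those of t^m, m < n.
shift-fixpoint-unique : ∀ (B X A A′ : Series) →
  (∀ n → A n ≡ B n + shiftS 1 (X ⊛ A) n) → (∀ n → A′ n ≡ B n + shiftS 1 (X ⊛ A′) n) → A ≗ A′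
shift-fixpoint-unique B X A A′ eqA eqA′ n = bounded n n ≤-refl
  where
  bounded : ∀ N n → n ≤ N → A n ≡ A′ n
  bounded N       zero    _         = trans (eqA 0) (sym (eqA′ 0))
  bounded (suc N) (suc n) (s≤s n≤N) = begin
    A (suc n)                  ≡⟨ eqA (suc n) ⟩
    B (suc n) + (X ⊛ A) n      ≡⟨ cong (B (suc n) +_) (sumTo-cong n (λ j _ →
                                    cong (X j *_) (bounded N (n ∸ j) (≤-trans (m∸n≤m n j) n≤N)))) ⟩
    B (suc n) + (X ⊛ A′) n     ≡⟨ eqA′ (suc n) ⟨
    A′ (suc n)                 ∎

⊛-fixpoint : ∀ (X Y B : Series) → Y ≗ (λ n → oneS n + shiftS 1 (X ⊛ Y) n) →
  Y ⊛ B ≗ λ n → B n + shiftS 1 (X ⊛ (Y ⊛ B)) n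
⊛-fixpoint X Y B Y≗1+tXY n = begin
  (Y ⊛ B) n                                       ≡⟨ ⊛-congˡ B Y≗1+tXY n ⟩
  ((λ j → oneS j + shiftS 1 (X ⊛ Y) j) ⊛ B) n     ≡⟨ ⊛-distribʳ-+ oneS (shiftS 1 (X ⊛ Y)) B n ⟩
  (oneS ⊛ B) n + (shiftS 1 (X ⊛ Y) ⊛ B) n         ≡⟨ cong₂ _+_ (⊛-identityˡ B n) (shiftS-⊛ˡ (X ⊛ Y) B n) ⟩
  B n + shiftS 1 ((X ⊛ Y) ⊛ B) n                  ≡⟨ cong (B n +_) (shiftS-cong 1 (⊛-assoc X Y B) n) ⟩
  B n + shiftS 1 (X ⊛ (Y ⊛ B)) n                  ∎

-- P C (n ∸ 1), except that it avoids the value P C (0 ∸ 1) = 1.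
_C⁻_ : ℕ → ℕ → ℕ
P C⁻ zero  = 0
P C⁻ suc n = P C n

[1+P]Cn≡PC⁻n+PCn : ∀ P n → suc P C n ≡ P C⁻ n + P C n
[1+P]Cn≡PC⁻n+PCn P zero    = refl
[1+P]Cn≡PC⁻n+PCn P (suc n) = sym (nCk+nC[k+1]≡[n+1]C[k+1] P n)

[1+m]*[m+e]C[1+m]≡e*[m+e]Cm : ∀ m e → suc m * ((m + e) C suc m) ≡ e * ((m + e) C m)
[1+m]*[m+e]C[1+m]≡e*[m+e]Cm zero e =
  trans (+-identityʳ _) (trans (nC1≡n e) (sym (*-identityʳ e)))
[1+m]*[m+e]C[1+m]≡e*[m+e]Cm (suc m) zero = begin
  suc (suc m) * ((suc m + 0) C suc (suc m))
    ≡⟨ cong (suc (suc m) *_) (k>n⇒nCk≡0 (s≤s (≤-reflexive (+-identityʳ (suc m))))) ⟩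
  suc (suc m) * 0
    ≡⟨ *-zeroʳ (suc (suc m)) ⟩
  0 ∎
[1+m]*[m+e]C[1+m]≡e*[m+e]Cm (suc m) (suc e) = begin
  suc (suc m) * ((suc m + suc e) C suc (suc m))
    ≡⟨ cong (λ P → suc (suc m) * (P C suc (suc m))) (+-suc (suc m) e) ⟩
  suc (suc m) * (suc N C suc (suc m))
    ≡⟨ cong (suc (suc m) *_) (nCk+nC[k+1]≡[n+1]C[k+1] N (suc m)) ⟨
  suc (suc m) * (N C suc m + N C suc (suc m))
    ≡⟨ *-distribˡ-+ (suc (suc m)) (N C suc m) _ ⟩
  suc (suc m) * (N C suc m) + suc (suc m) * (N C suc (suc m))
    ≡⟨ cong (suc (suc m) * (N C suc m) +_) ([1+m]*[m+e]C[1+m]≡e*[m+e]Cm (suc m) e) ⟩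
  suc (suc m) * (N C suc m) + e * (N C suc m)
    ≡⟨ shuffle (suc m) e (N C suc m) ⟩
  suc m * (N C suc m) + suc e * (N C suc m)
    ≡⟨ cong (_+ suc e * (N C suc m)) previous ⟩
  suc e * (N C m) + suc e * (N C suc m)
    ≡⟨ *-distribˡ-+ (suc e) (N C m) _ ⟨
  suc e * (N C m + N C suc m)
    ≡⟨ cong (suc e *_) (nCk+nC[k+1]≡[n+1]C[k+1] N m) ⟩
  suc e * (suc N C suc m)
    ≡⟨ cong (λ P → suc e * (P C suc m)) (+-suc (suc m) e) ⟨
  suc e * ((suc m + suc e) C suc m) ∎
  where
  N : ℕ
  N = suc m + e
  shuffle : ∀ a e x → suc a * x + e * x ≡ a * x + suc e * x
  shuffle = solve-∀
  previous : suc m * (N C suc m) ≡ suc e * (N C m)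
  previous = subst (λ P → suc m * (P C suc m) ≡ suc e * (P C m)) (+-suc m e)
                   ([1+m]*[m+e]C[1+m]≡e*[m+e]Cm m (suc e))

sum-map-const0 : ∀ {A : Set} (xs : List A) → sum (map (const 0) xs) ≡ 0
sum-map-const0 []       = refl
sum-map-const0 (x ∷ xs) = sum-map-const0 xs

sum-map-if : ∀ {A : Set} c (f : A → ℕ) xs →
  sum (map (λ x → if c then f x else 0) xs) ≡ (if c then sum (map f xs) else 0)
sum-map-if true  f xs = refl
sum-map-if false f xs = sum-map-const0 xs

sum-allWords-suc : ∀ (f : List Step → ℕ) L →
  sum (map f (allWords (suc L))) ≡ sum (map (f ∘ (U ∷_)) (allWords L)) + sum (map (f ∘ (D ∷_)) (allWords L))
sum-allWords-suc f L = go (allWords L)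
  where
  go : ∀ ws → sum (map f (concatMap (λ w → (U ∷ w) ∷ (D ∷ w) ∷ []) ws))
                ≡ sum (map (f ∘ (U ∷_)) ws) + sum (map (f ∘ (D ∷_)) ws)
  go []       = refl
  go (w ∷ ws) = trans (cong (λ s → f (U ∷ w) + (f (D ∷ w) + s)) (go ws))
                      (shuffle (f (U ∷ w)) (f (D ∷ w)) _ _)
    where
    shuffle : ∀ a b c d → a + (b + (c + d)) ≡ a + c + (b + d)
    shuffle = solve-∀

sum-allWords-cong : ∀ L {f g : List Step → ℕ} → (∀ w → length w ≡ L → f w ≡ g w) →
  sum (map f (allWords L)) ≡ sum (map g (allWords L))
sum-allWords-cong zero    f≡g = cong (_+ 0) (f≡g [] refl)
sum-allWords-cong (suc L) {f} {g} f≡g = begin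
  sum (map f (allWords (suc L)))
    ≡⟨ sum-allWords-suc f L ⟩
  sum (map (f ∘ (U ∷_)) (allWords L)) + sum (map (f ∘ (D ∷_)) (allWords L))
    ≡⟨ cong₂ _+_ (sum-allWords-cong L (λ w ∣w∣≡L → f≡g (U ∷ w) (cong suc ∣w∣≡L)))
                 (sum-allWords-cong L (λ w ∣w∣≡L → f≡g (D ∷ w) (cong suc ∣w∣≡L))) ⟩
  sum (map (g ∘ (U ∷_)) (allWords L)) + sum (map (g ∘ (D ∷_)) (allWords L))
    ≡⟨ sum-allWords-suc g L ⟨
  sum (map g (allWords (suc L))) ∎

≡ᵇ-false : ∀ {m n} → m ≢ n → (m ≡ᵇ n) ≡ false
≡ᵇ-false {m} {n} m≢n with m ≡ᵇ n in eq
... | false = refl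
... | true  = contradiction (≡ᵇ⇒≡ m n (Equivalence.from T-≡ eq)) m≢n

≡ᵇ-true : ∀ {m n} → m ≡ n → (m ≡ᵇ n) ≡ true
≡ᵇ-true {m} m≡n = Equivalence.to T-≡ (≡⇒≡ᵇ m _ m≡n)

≤ᵇ-true : ∀ {m n} → m ≤ n → (m ≤ᵇ n) ≡ true
≤ᵇ-true m≤n = Equivalence.to T-≡ (≤⇒≤ᵇ m≤n)

≤ᵇ-false : ∀ {m n} → n < m → (m ≤ᵇ n) ≡ false
≤ᵇ-false {m} {n} n<m with m ≤ᵇ n in eq
... | false = refl
... | true  = contradiction (≤ᵇ⇒≤ m n (Equivalence.from T-≡ eq)) (<⇒≱ n<m)

k*[1+n]+b≡k*n+b+k : ∀ k n b → k * suc n + b ≡ k * n + b + k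
k*[1+n]+b≡k*n+b+k k n b = trans (cong (_+ b) (*-suc k n)) (shuffle k (k * n) b)
  where
  shuffle : ∀ k kn b → k + kn + b ≡ kn + b + k
  shuffle = solve-∀

exactly : ℕ → ℕ → ℕ
exactly ρ r = if r ≡ᵇ ρ then 1 else 0

module Walks (k : ℕ) .{{_ : NonZero k}} where

  bump : ℕ → ℕ → ℕ
  bump h r = if suc h ∸ k ≡ᵇ 0 then suc r else r

  -- walks W L h b sums W (number of returns) over the walks of length L from h to b staying above
  -- ground; once a first step D has returned, the rest of the walk is weighted by W ∘ suc.
  walks : (ℕ → ℕ) → ℕ → ℕ → ℕ → ℕ
  walks W zero    h b = if h ≡ᵇ b then W 0 else 0
  walks W (suc L) h b = walks W L (suc h) b + (if k ≤ᵇ suc h then walks (W ∘ bump h) L (suc h ∸ k) b else 0)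

  walks-cong : ∀ L {W W′} h b → W ≗ W′ → walks W L h b ≡ walks W′ L h b
  walks-cong zero    h b W≗W′ = cong (λ w → if h ≡ᵇ b then w else 0) (W≗W′ 0)
  walks-cong (suc L) h b W≗W′ = cong₂ _+_ (walks-cong L (suc h) b W≗W′)
    (cong (λ w → if k ≤ᵇ suc h then w else 0) (walks-cong L (suc h ∸ k) b (W≗W′ ∘ bump h)))

  walks-zero : ∀ L {W} h b → (∀ r → W r ≡ 0) → walks W L h b ≡ 0
  walks-zero zero    h b W≡0 with h ≡ᵇ b
  ... | true  = W≡0 0
  ... | false = refl
  walks-zero (suc L) h b W≡0 with k ≤ᵇ suc h
  ... | true  = cong₂ _+_ (walks-zero L (suc h) b W≡0) (walks-zero L (suc h ∸ k) b (W≡0 ∘ bump h))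
  ... | false = cong (_+ 0) (walks-zero L (suc h) b W≡0)

  walks-unreachable : ∀ L W h b → h + L < b → walks W L h b ≡ 0
  walks-unreachable zero    W h b h+0<b =
    cong (λ c → if c then W 0 else 0) (≡ᵇ-false (<⇒≢ (subst (_< b) (+-identityʳ h) h+0<b)))
  walks-unreachable (suc L) W h b h+L<b with k ≤ᵇ suc h
  ... | true  = cong₂ _+_ (walks-unreachable L W (suc h) b suc-h+L<b)
                          (walks-unreachable L (W ∘ bump h) (suc h ∸ k) b
                            (≤-<-trans (+-monoˡ-≤ L (m∸n≤m (suc h) k)) suc-h+L<b))
    where
    suc-h+L<b : suc h + L < b
    suc-h+L<b = subst (_< b) (+-suc h L) h+L<b
  ... | false = cong (_+ 0) (walks-unreachable L W (suc h) b (subst (_< b) (+-suc h L) h+L<b))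

  weight : (ℕ → ℕ) → ℕ → ℕ → List Step → ℕ
  weight W h b w with walk k h w
  ... | nothing      = 0
  ... | just (x , r) = if x ≡ᵇ b then W r else 0

  weight-U : ∀ W h b w → weight W h b (U ∷ w) ≡ weight W (suc h) b w
  weight-U W h b w with walk k (suc h) w
  ... | nothing      = refl
  ... | just (x , r) = refl

  weight-D : ∀ W h b w →
    weight W h b (D ∷ w) ≡ (if k ≤ᵇ suc h then weight (W ∘ bump h) (suc h ∸ k) b w else 0)
  weight-D W h b w with k ≤ᵇ suc h
  ... | false = refl
  ... | true with walk k (suc h ∸ k) w
  ...   | nothing      = refl
  ...   | just (x , r) = refl

  sum-weight≡walks : ∀ L W h b → sum (map (weight W h b) (allWords L)) ≡ walks W L h b
  sum-weight≡walks zero    W h b = +-identityʳ _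
  sum-weight≡walks (suc L) W h b = begin
    sum (map (weight W h b) (allWords (suc L)))
      ≡⟨ sum-allWords-suc (weight W h b) L ⟩
    sum (map (weight W h b ∘ (U ∷_)) (allWords L)) + sum (map (weight W h b ∘ (D ∷_)) (allWords L))
      ≡⟨ cong₂ _+_ (cong sum (map-cong (weight-U W h b) (allWords L)))
                   (cong sum (map-cong (weight-D W h b) (allWords L))) ⟩
    sum (map (weight W (suc h) b) (allWords L))
      + sum (map (λ w → if k ≤ᵇ suc h then weight (W ∘ bump h) (suc h ∸ k) b w else 0) (allWords L))
      ≡⟨ cong₂ _+_ (sum-weight≡walks L W (suc h) b)
                   (sum-map-if (k ≤ᵇ suc h) (weight (W ∘ bump h) (suc h ∸ k) b) (allWords L)) ⟩
    walks W L (suc h) b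
      + (if k ≤ᵇ suc h then sum (map (weight (W ∘ bump h) (suc h ∸ k) b) (allWords L)) else 0)
      ≡⟨ cong (λ s → walks W L (suc h) b + (if k ≤ᵇ suc h then s else 0))
              (sum-weight≡walks L (W ∘ bump h) (suc h ∸ k) b) ⟩
    walks W (suc L) h b ∎

  walk-height : ∀ h w {x r} → walk k h w ≡ just (x , r) → h + length w ≡ x + k * countD w
  walk-height h []      refl = trans (+-identityʳ h) (sym (trans (cong (h +_) (*-zeroʳ k)) (+-identityʳ h)))
  walk-height h (U ∷ w) eq   = trans (+-suc h (length w)) (walk-height (suc h) w eq)
  walk-height h (D ∷ w) eq with k ≤ᵇ suc h in k≤
  walk-height h (D ∷ w) eq | true with walk k (suc h ∸ k) w in eq′
  walk-height h (D ∷ w) refl | true | just (x , r) = begin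
    h + suc (length w)                ≡⟨ +-suc h (length w) ⟩
    suc h + length w                  ≡⟨ cong (_+ length w) (m∸n+n≡m (≤ᵇ⇒≤ k (suc h) (Equivalence.from T-≡ k≤))) ⟨
    suc h ∸ k + k + length w          ≡⟨ shuffle (suc h ∸ k) k (length w) ⟩
    suc h ∸ k + length w + k          ≡⟨ cong (_+ k) (walk-height (suc h ∸ k) w eq′) ⟩
    x + k * countD w + k              ≡⟨ shuffle x (k * countD w) k ⟩
    x + k + k * countD w              ≡⟨ +-assoc x k _ ⟩
    x + (k + k * countD w)            ≡⟨ cong (x +_) (*-suc k (countD w)) ⟨
    x + k * suc (countD w)            ∎
    where
    shuffle : ∀ a b c → a + b + c ≡ a + c + b
    shuffle = solve-∀

  countD-determined : ∀ n α β w {r} → length w ≡ pathLen k n α β → walk k α w ≡ just (β , r) → countD w ≡ n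
  countD-determined n α β w ∣w∣≡L eq with α ≤? k * n + β
  ... | yes α≤ = *-cancelˡ-≡ (countD w) n k (+-cancelˡ-≡ β _ _ (begin
    β + k * countD w   ≡⟨ walk-height α w eq ⟨
    α + length w       ≡⟨ cong (α +_) ∣w∣≡L ⟩
    α + (k * n + β ∸ α) ≡⟨ m+[n∸m]≡n α≤ ⟩
    k * n + β          ≡⟨ +-comm (k * n) β ⟩
    β + k * n          ∎))
  ... | no α≰ with w | eq | trans ∣w∣≡L (m≤n⇒m∸n≡0 (<⇒≤ (≰⇒> α≰)))
  ...   | [] | refl | _ = contradiction (m≤n+m α (k * n)) α≰

  countD-test-redundant : ∀ n α β w {x r} → length w ≡ pathLen k n α β → walk k α w ≡ just (x , r) →
    (countD w ≡ᵇ n) ∧ (x ≡ᵇ β) ≡ (x ≡ᵇ β)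
  countD-test-redundant n α β w {x} ∣w∣≡L eq with x ≡ᵇ β in xβ
  ... | false = ∧-zeroʳ (countD w ≡ᵇ n)
  ... | true  rewrite ≡ᵇ⇒≡ x β (Equivalence.from T-≡ xβ)
                    | Equivalence.to T-≡ (≡⇒≡ᵇ _ _ (countD-determined n α β w ∣w∣≡L eq)) = refl

  isPathRet≡weight : ∀ n α β ρ w → length w ≡ pathLen k n α β →
    (if isPathRet k n α β ρ w then 1 else 0) ≡ weight (exactly ρ) α β w
  isPathRet≡weight n α β ρ w ∣w∣≡L with walk k α w in eq
  ... | nothing      = refl
  ... | just (x , r) rewrite sym (∧-assoc (countD w ≡ᵇ n) (x ≡ᵇ β) (r ≡ᵇ ρ))
                           | countD-test-redundant n α β w ∣w∣≡L eq with x ≡ᵇ β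
  ...   | true  = refl
  ...   | false = refl

  isPath≡weight : ∀ n α β w → length w ≡ pathLen k n α β →
    (if isPath k n α β w then 1 else 0) ≡ weight (const 1) α β w
  isPath≡weight n α β w ∣w∣≡L with walk k α w in eq
  ... | nothing      = refl
  ... | just (x , r) rewrite countD-test-redundant n α β w ∣w∣≡L eq with x ≡ᵇ β
  ...   | true  = refl
  ...   | false = refl

  -- A walk from h to b with n steps D has length k * n + b ∸ h.
  paths : (ℕ → ℕ) → ℕ → ℕ → Series
  paths W h b n = walks W (k * n + b ∸ h) h b

  Cret≡paths : ∀ n α β ρ → Cret k n α β ρ ≡ paths (exactly ρ) α β n
  Cret≡paths n α β ρ =
    trans (sum-allWords-cong (pathLen k n α β) (isPathRet≡weight n α β ρ))
          (sum-weight≡walks (pathLen k n α β) (exactly ρ) α β)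

  Cnat≡paths : ∀ n α β → Cnat k n α β ≡ paths (const 1) α β n
  Cnat≡paths n α β =
    trans (sum-allWords-cong (pathLen k n α β) (isPath≡weight n α β))
          (sum-weight≡walks (pathLen k n α β) (const 1) α β)

  downStep : (ℕ → ℕ) → ℕ → ((ℕ → ℕ) → ℕ → ℕ) → ℕ
  downStep W h g = if k ≤ᵇ suc h then g (W ∘ bump h) (suc h ∸ k) else 0

  WeightInvariant : ((ℕ → ℕ) → ℕ → ℕ) → ℕ → Set
  WeightInvariant g h = ∀ {V V′} → V ≗ V′ → g V h ≡ g V′ h

  walksTo : ℕ → ℕ → (ℕ → ℕ) → ℕ → ℕ
  walksTo L b V h = walks V L h b

  walksTo-invariant : ∀ L b h → WeightInvariant (walksTo L b) h
  walksTo-invariant L b h = walks-cong L h b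

  pathsTo : ℕ → ℕ → (ℕ → ℕ) → ℕ → ℕ
  pathsTo b n V h = paths V h b n

  pathsTo-invariant : ∀ b n h → WeightInvariant (pathsTo b n) h
  pathsTo-invariant b n h = walks-cong (k * n + b ∸ h) h b

  data DownFrom (h : ℕ) : Set where
    blocked : suc h < k → DownFrom h
    returns : suc h ≡ k → DownFrom h
    lands   : ∀ e → suc h ≡ k + suc e → DownFrom h

  downFrom : ∀ h → DownFrom h
  downFrom h with <-cmp (suc h) k
  ... | tri< k>1+h _ _ = blocked k>1+h
  ... | tri≈ _ 1+h≡k _ = returns 1+h≡k
  ... | tri> _ _ k<1+h =
    lands (h ∸ k) (sym (trans (+-suc k (h ∸ k)) (cong suc (m+[n∸m]≡n (s≤s⁻¹ k<1+h)))))

  downStep-cong : ∀ W h {g g′} → (∀ V h′ → g V h′ ≡ g′ V h′) → downStep W h g ≡ downStep W h g′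
  downStep-cong W h g≡g′ = cong (λ x → if k ≤ᵇ suc h then x else 0) (g≡g′ _ _)

  downStep-distrib-+ : ∀ W h g g′ → downStep W h (λ V h′ → g V h′ + g′ V h′) ≡ downStep W h g + downStep W h g′
  downStep-distrib-+ W h g g′ with k ≤ᵇ suc h
  ... | true  = refl
  ... | false = refl

  downStep-blocked : ∀ W h g → suc h < k → downStep W h g ≡ 0
  downStep-blocked W h g 1+h<k rewrite ≤ᵇ-false 1+h<k = refl

  downStep-allowed : ∀ W h g → k ≤ suc h → downStep W h g ≡ g (W ∘ bump h) (suc h ∸ k)
  downStep-allowed W h g k≤1+h rewrite ≤ᵇ-true k≤1+h = refl

  downStep-returns : ∀ W h g → suc h ≡ k → WeightInvariant g 0 → downStep W h g ≡ g (W ∘ suc) 0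
  downStep-returns W h g 1+h≡k g-inv = begin
    downStep W h g                 ≡⟨ downStep-allowed W h g (≤-reflexive (sym 1+h≡k)) ⟩
    g (W ∘ bump h) (suc h ∸ k)     ≡⟨ cong (g (W ∘ bump h)) lands0 ⟩
    g (W ∘ bump h) 0               ≡⟨ g-inv (λ r → cong (λ c → W (if c then suc r else r)) (cong (_≡ᵇ 0) lands0)) ⟩
    g (W ∘ suc) 0                  ∎
    where
    lands0 : suc h ∸ k ≡ 0
    lands0 = trans (cong (_∸ k) 1+h≡k) (n∸n≡0 k)

  downStep-lands : ∀ W h g e → suc h ≡ k + suc e → WeightInvariant g (suc e) → downStep W h g ≡ g W (suc e)
  downStep-lands W h g e 1+h≡k+1+e g-inv = begin
    downStep W h g                 ≡⟨ downStep-allowed W h g (subst (k ≤_) (sym 1+h≡k+1+e) (m≤m+n k (suc e))) ⟩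
    g (W ∘ bump h) (suc h ∸ k)     ≡⟨ cong (g (W ∘ bump h)) landsAt ⟩
    g (W ∘ bump h) (suc e)         ≡⟨ g-inv (λ r → cong (λ c → W (if c then suc r else r)) (cong (_≡ᵇ 0) landsAt)) ⟩
    g W (suc e)                    ∎
    where
    landsAt : suc h ∸ k ≡ suc e
    landsAt = trans (cong (_∸ k) 1+h≡k+1+e) (m+n∸m≡n k (suc e))

  downStep-const1 : ∀ h g e → suc h ≡ k + e → downStep (const 1) h g ≡ g (const 1) e
  downStep-const1 h g e 1+h≡k+e =
    trans (downStep-allowed (const 1) h g (subst (k ≤_) (sym 1+h≡k+e) (m≤m+n k e)))
          (cong (g (const 1)) (trans (cong (_∸ k) 1+h≡k+e) (m+n∸m≡n k e)))

  firstDown : (ℕ → ℕ) → ℕ → ℕ → Series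
  firstDown W h b zero    = 0
  firstDown W h b (suc n) = downStep W h (pathsTo b n)

  emptyPath : (ℕ → ℕ) → ℕ → ℕ → Series
  emptyPath W h b zero    = if h ≡ᵇ b then W 0 else 0
  emptyPath W h b (suc n) = 0

  paths-vanish : ∀ W h b n → k * n + b < h → paths W h b n ≡ 0
  paths-vanish W h b n kn+b<h rewrite m≤n⇒m∸n≡0 (<⇒≤ kn+b<h) =
    cong (λ c → if c then W 0 else 0)
         (≡ᵇ-false λ h≡b → <⇒≱ kn+b<h (subst (_≤ k * n + b) (sym h≡b) (m≤n+m b (k * n))))

  firstDown-vanish : ∀ W h b n → k * n + b ≤ h → firstDown W h b n ≡ 0
  firstDown-vanish W h b zero    _ = refl
  firstDown-vanish W h b (suc n) k[1+n]+b≤h with k ≤? suc h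
  ... | no  k≰1+h = downStep-blocked W h (pathsTo b n) (≰⇒> k≰1+h)
  ... | yes k≤1+h = trans (downStep-allowed W h (pathsTo b n) k≤1+h)
                          (paths-vanish (W ∘ bump h) (suc h ∸ k) b n kn+b<landing)
    where
    kn+b<landing : k * n + b < suc h ∸ k
    kn+b<landing = +-cancelʳ-< k (k * n + b) (suc h ∸ k)
      (subst₂ _<_ (k*[1+n]+b≡k*n+b+k k n b) (sym (m∸n+n≡m k≤1+h)) (s≤s k[1+n]+b≤h))

  firstDown-blocked : ∀ W h b n → suc h < k → firstDown W h b n ≡ 0
  firstDown-blocked W h b zero    _     = refl
  firstDown-blocked W h b (suc n) 1+h<k = downStep-blocked W h (pathsTo b n) 1+h<k

  emptyPath-vanish : ∀ W h b n → h < k * n + b → emptyPath W h b n ≡ 0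
  emptyPath-vanish W h b zero    h<k0+b = cong (λ c → if c then W 0 else 0)
    (≡ᵇ-false (<⇒≢ (subst (h <_) (cong (_+ b) (*-zeroʳ k)) h<k0+b)))
  emptyPath-vanish W h b (suc n) _      = refl

  emptyPath-weight : ∀ W h b n → emptyPath W h b n ≡ W 0 * emptyPath (exactly 0) h b n
  emptyPath-weight W h b zero with h ≡ᵇ b
  ... | true  = sym (*-identityʳ (W 0))
  ... | false = sym (*-zeroʳ (W 0))
  emptyPath-weight W h b (suc n) = sym (*-zeroʳ (W 0))

  downWalks≡firstDown : ∀ W h b n L → L + suc h ≡ k * n + b →
    downStep W h (walksTo L b) ≡ firstDown W h b n
  downWalks≡firstDown W h b n L L+1+h≡kn+b with k ≤? suc h
  downWalks≡firstDown W h b zero    L L+1+h≡b | no k≰1+h =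
    downStep-blocked W h (walksTo L b) (≰⇒> k≰1+h)
  downWalks≡firstDown W h b (suc n) L _       | no k≰1+h =
    trans (downStep-blocked W h (walksTo L b) (≰⇒> k≰1+h))
          (sym (downStep-blocked W h (pathsTo b n) (≰⇒> k≰1+h)))
  downWalks≡firstDown W h b zero    L L+1+h≡b | yes k≤1+h =
    trans (downStep-allowed W h (walksTo L b) k≤1+h)
          (walks-unreachable L (W ∘ bump h) (suc h ∸ k) b
            (subst (suc h ∸ k + L <_) (trans (+-comm (suc h) L) (trans L+1+h≡b (cong (_+ b) (*-zeroʳ k))))
                   (+-monoˡ-< L (s≤s (∸-monoʳ-≤ (suc h) (>-nonZero⁻¹ k))))))
  downWalks≡firstDown W h b (suc n) L L+1+h≡kn+b | yes k≤1+h = begin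
    downStep W h (walksTo L b)
      ≡⟨ downStep-allowed W h (walksTo L b) k≤1+h ⟩
    walks (W ∘ bump h) L (suc h ∸ k) b
      ≡⟨ cong (λ L → walks (W ∘ bump h) L (suc h ∸ k) b) L≡ ⟩
    paths (W ∘ bump h) (suc h ∸ k) b n
      ≡⟨ downStep-allowed W h (pathsTo b n) k≤1+h ⟨
    downStep W h (pathsTo b n) ∎
    where
    L+landing≡kn+b : L + (suc h ∸ k) ≡ k * n + b
    L+landing≡kn+b = +-cancelʳ-≡ k _ _ (begin
      L + (suc h ∸ k) + k    ≡⟨ +-assoc L (suc h ∸ k) k ⟩
      L + (suc h ∸ k + k)    ≡⟨ cong (L +_) (m∸n+n≡m k≤1+h) ⟩
      L + suc h              ≡⟨ L+1+h≡kn+b ⟩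
      k * suc n + b          ≡⟨ k*[1+n]+b≡k*n+b+k k n b ⟩
      k * n + b + k          ∎)
    L≡ : L ≡ k * n + b ∸ (suc h ∸ k)
    L≡ = trans (sym (m+n∸n≡m L (suc h ∸ k))) (cong (_∸ (suc h ∸ k)) L+landing≡kn+b)

  walks-firstStep : ∀ W h b n L → k * n + b ∸ h ≡ L →
    walks W L h b ≡ paths W (suc h) b n + firstDown W h b n + emptyPath W h b n
  walks-firstStep W h b n zero kn+b∸h≡0
    rewrite paths-vanish W (suc h) b n (s≤s (m∸n≡0⇒m≤n kn+b∸h≡0))
          | firstDown-vanish W h b n (m∸n≡0⇒m≤n kn+b∸h≡0) with n
  ... | zero  = refl
  ... | suc m = cong (λ c → if c then W 0 else 0) (≡ᵇ-false λ h≡b → <⇒≱ b<h (≤-reflexive h≡b))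
    where
    b<h : b < h
    b<h = <-≤-trans (≤-<-trans (m≤n+m b (k * m)) (m<m+n (k * m + b) (>-nonZero⁻¹ k)))
                    (subst (_≤ h) (k*[1+n]+b≡k*n+b+k k m b) (m∸n≡0⇒m≤n kn+b∸h≡0))
  walks-firstStep W h b n (suc L) kn+b∸h≡1+L = begin
    walks W L (suc h) b + downStep W h (walksTo L b)
      ≡⟨ cong₂ _+_ (cong (λ L → walks W L (suc h) b) L≡) (downWalks≡firstDown W h b n L L+1+h≡kn+b) ⟩
    paths W (suc h) b n + firstDown W h b n
      ≡⟨ +-identityʳ _ ⟨
    paths W (suc h) b n + firstDown W h b n + 0
      ≡⟨ cong (paths W (suc h) b n + firstDown W h b n +_) (emptyPath-vanish W h b n h<kn+b) ⟨
    paths W (suc h) b n + firstDown W h b n + emptyPath W h b n ∎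
    where
    h<kn+b : h < k * n + b
    h<kn+b = m∸n≢0⇒n<m λ kn+b∸h≡0 → 0≢1+n (trans (sym kn+b∸h≡0) kn+b∸h≡1+L)
    L+1+h≡kn+b : L + suc h ≡ k * n + b
    L+1+h≡kn+b = trans (+-suc L h) (trans (cong (_+ h) (sym kn+b∸h≡1+L)) (m∸n+n≡m (<⇒≤ h<kn+b)))
    L≡ : L ≡ k * n + b ∸ suc h
    L≡ = trans (sym (m+n∸n≡m L (suc h))) (cong (_∸ suc h) L+1+h≡kn+b)

  paths-firstStep : ∀ W h b n → paths W h b n ≡ paths W (suc h) b n + firstDown W h b n + emptyPath W h b n
  paths-firstStep W h b n = walks-firstStep W h b n (k * n + b ∸ h) refl

  walks-nonReturning : ∀ L h b → walks (exactly 0) L (suc h) (suc b) ≡ walks (const 1) L h b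
  walks-nonReturning zero    h b = refl
  walks-nonReturning (suc L) h b = cong₂ _+_ (walks-nonReturning L (suc h) b) (down (downFrom (suc h)))
    where
    down : DownFrom (suc h) →
      downStep (exactly 0) (suc h) (walksTo L (suc b)) ≡ downStep (const 1) h (walksTo L b)
    down (blocked 2+h<k) = trans (downStep-blocked (exactly 0) (suc h) (walksTo L (suc b)) 2+h<k)
                                 (sym (downStep-blocked (const 1) h (walksTo L b) (<-trans (n<1+n (suc h)) 2+h<k)))
    down (returns 2+h≡k) = begin
      downStep (exactly 0) (suc h) (walksTo L (suc b))
        ≡⟨ downStep-returns (exactly 0) (suc h) (walksTo L (suc b)) 2+h≡k (walksTo-invariant L (suc b) 0) ⟩
      walks (exactly 0 ∘ suc) L 0 (suc b)
        ≡⟨ walks-zero L 0 (suc b) (λ _ → refl) ⟩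
      0
        ≡⟨ downStep-blocked (const 1) h (walksTo L b) (≤-reflexive 2+h≡k) ⟨
      downStep (const 1) h (walksTo L b) ∎
    down (lands e 2+h≡k+1+e) = begin
      downStep (exactly 0) (suc h) (walksTo L (suc b))
        ≡⟨ downStep-lands (exactly 0) (suc h) (walksTo L (suc b)) e 2+h≡k+1+e
                          (walksTo-invariant L (suc b) (suc e)) ⟩
      walks (exactly 0) L (suc e) (suc b)
        ≡⟨ walks-nonReturning L e b ⟩
      walks (const 1) L e b
        ≡⟨ downStep-const1 h (walksTo L b) e (suc-injective (trans 2+h≡k+1+e (+-suc k e))) ⟨
      downStep (const 1) h (walksTo L b) ∎

  walks-nonReturning-ground : ∀ L h → walks (exactly 0) L (suc h) 0 ≡ 0
  walks-nonReturning-ground zero    h = refl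
  walks-nonReturning-ground (suc L) h = cong₂ _+_ (walks-nonReturning-ground L (suc h)) (down (downFrom (suc h)))
    where
    down : DownFrom (suc h) → downStep (exactly 0) (suc h) (walksTo L 0) ≡ 0
    down (blocked 2+h<k)     = downStep-blocked (exactly 0) (suc h) (walksTo L 0) 2+h<k
    down (returns 2+h≡k)     = trans (downStep-returns (exactly 0) (suc h) (walksTo L 0) 2+h≡k
                                                       (walksTo-invariant L 0 0))
                                     (walks-zero L 0 0 (λ _ → refl))
    down (lands e 2+h≡k+1+e) = trans (downStep-lands (exactly 0) (suc h) (walksTo L 0) e 2+h≡k+1+e
                                                     (walksTo-invariant L 0 (suc e)))
                                     (walks-nonReturning-ground L e)

  paths-nonReturning : ∀ h b → paths (exactly 0) (suc h) (suc b) ≗ paths (const 1) h b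
  paths-nonReturning h b n =
    trans (cong (λ L → walks (exactly 0) (L ∸ suc h) (suc h) (suc b)) (+-suc (k * n) b))
          (walks-nonReturning (k * n + b ∸ h) h b)

  paths-nonReturning-ground : ∀ h → paths (exactly 0) (suc h) 0 ≗ const 0
  paths-nonReturning-ground h n = walks-nonReturning-ground (k * n + 0 ∸ suc h) h

  downStep-weight-suc : ∀ W h L b →
    downStep W h (λ V h′ → walks (V ∘ suc) L h′ b) ≡ downStep (W ∘ suc) h (walksTo L b)
  downStep-weight-suc W h L b =
    cong (λ x → if k ≤ᵇ suc h then x else 0) (walks-cong L (suc h ∸ k) b (λ r → cong W (bump-suc r)))
    where
    bump-suc : ∀ r → bump h (suc r) ≡ suc (bump h r)
    bump-suc r with suc h ∸ k ≡ᵇ 0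
    ... | true  = refl
    ... | false = refl

  walks-lastStep-ground : ∀ L W h → walks W (suc L) h 0 ≡ walks (W ∘ suc) L h (pred k)
  walks-lastStep-ground zero W h = final (downFrom h)
    where
    h≢pred-k : suc h ≢ k → h ≢ pred k
    h≢pred-k 1+h≢k h≡pred-k = 1+h≢k (trans (cong suc h≡pred-k) (suc-pred k))
    final : DownFrom h → downStep W h (walksTo 0 0) ≡ (if h ≡ᵇ pred k then W 1 else 0)
    final (blocked 1+h<k)   = trans (downStep-blocked W h (walksTo 0 0) 1+h<k)
      (cong (λ c → if c then W 1 else 0) (sym (≡ᵇ-false (h≢pred-k (<⇒≢ 1+h<k)))))
    final (returns 1+h≡k)   = trans (downStep-returns W h (walksTo 0 0) 1+h≡k (walksTo-invariant 0 0 0))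
      (cong (λ c → if c then W 1 else 0) (sym (≡ᵇ-true (cong pred 1+h≡k))))
    final (lands e 1+h≡k+1+e) =
      trans (downStep-lands W h (walksTo 0 0) e 1+h≡k+1+e (walksTo-invariant 0 0 (suc e)))
      (cong (λ c → if c then W 1 else 0) (sym (≡ᵇ-false (h≢pred-k λ 1+h≡k →
        <⇒≢ (subst (k <_) (sym 1+h≡k+1+e) (m<m+n k z<s)) (sym 1+h≡k)))))
  walks-lastStep-ground (suc L) W h = begin
    walks W (suc L) (suc h) 0 + downStep W h (walksTo (suc L) 0)
      ≡⟨ cong₂ _+_ (walks-lastStep-ground L W (suc h))
                   (downStep-cong W h (λ V h′ → walks-lastStep-ground L V h′)) ⟩
    walks (W ∘ suc) L (suc h) (pred k) + downStep W h (λ V h′ → walks (V ∘ suc) L h′ (pred k))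
      ≡⟨ cong (walks (W ∘ suc) L (suc h) (pred k) +_) (downStep-weight-suc W h L (pred k)) ⟩
    walks (W ∘ suc) (suc L) h (pred k) ∎

  walks-lastStep : ∀ L W h b → walks W (suc L) h (suc b) ≡ walks W L h b + walks W L h (b + k)
  walks-lastStep zero W h b = cong (walks W 0 h b +_) (final (downFrom h))
    where
    h≢b+k : h < k → h ≢ b + k
    h≢b+k h<k h≡b+k = <⇒≱ h<k (subst (k ≤_) (sym h≡b+k) (m≤n+m k b))
    final : DownFrom h → downStep W h (walksTo 0 (suc b)) ≡ (if h ≡ᵇ b + k then W 0 else 0)
    final (blocked 1+h<k)   = trans (downStep-blocked W h (walksTo 0 (suc b)) 1+h<k)
      (cong (λ c → if c then W 0 else 0) (sym (≡ᵇ-false (h≢b+k (<-trans (n<1+n h) 1+h<k)))))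
    final (returns 1+h≡k)   =
      trans (downStep-returns W h (walksTo 0 (suc b)) 1+h≡k (walksTo-invariant 0 (suc b) 0))
      (cong (λ c → if c then W 0 else 0) (sym (≡ᵇ-false (h≢b+k (≤-reflexive 1+h≡k)))))
    final (lands e 1+h≡k+1+e) =
      trans (downStep-lands W h (walksTo 0 (suc b)) e 1+h≡k+1+e (walksTo-invariant 0 (suc b) (suc e)))
            (cong (λ c → if c then W 0 else 0) (same-test (e ≟ b)))
      where
      h≡k+e : h ≡ k + e
      h≡k+e = suc-injective (trans 1+h≡k+1+e (+-suc k e))
      same-test : Dec (e ≡ b) → (e ≡ᵇ b) ≡ (h ≡ᵇ b + k)
      same-test (yes e≡b) =
        trans (≡ᵇ-true e≡b) (sym (≡ᵇ-true (trans h≡k+e (trans (+-comm k e) (cong (_+ k) e≡b)))))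
      same-test (no  e≢b) = trans (≡ᵇ-false e≢b) (sym (≡ᵇ-false λ h≡b+k →
        e≢b (+-cancelˡ-≡ k e b (trans (sym h≡k+e) (trans h≡b+k (+-comm b k))))))
  walks-lastStep (suc L) W h b = begin
    walks W (suc L) (suc h) (suc b) + downStep W h (walksTo (suc L) (suc b))
      ≡⟨ cong₂ _+_ (walks-lastStep L W (suc h) b) (downStep-cong W h (λ V h′ → walks-lastStep L V h′ b)) ⟩
    walks W L (suc h) b + walks W L (suc h) (b + k) + downStep W h (λ V h′ → walks V L h′ b + walks V L h′ (b + k))
      ≡⟨ cong (walks W L (suc h) b + walks W L (suc h) (b + k) +_)
              (downStep-distrib-+ W h (walksTo L b) (walksTo L (b + k))) ⟩
    walks W L (suc h) b + walks W L (suc h) (b + k) + (downStep W h (walksTo L b) + downStep W h (walksTo L (b + k)))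
      ≡⟨ shuffle (walks W L (suc h) b) (walks W L (suc h) (b + k)) _ _ ⟩
    walks W (suc L) h b + walks W (suc L) h (b + k) ∎
    where
    shuffle : ∀ a b c d → a + b + (c + d) ≡ a + c + (b + d)
    shuffle = solve-∀

  paths-lastStep : ∀ W b n → paths W 0 (suc b) n ≡ paths W 0 b n + shiftS 1 (paths W 0 (b + k)) n
  paths-lastStep W b n = begin
    walks W (k * n + suc b) 0 (suc b)
      ≡⟨ cong (λ L → walks W L 0 (suc b)) (+-suc (k * n) b) ⟩
    walks W (suc (k * n + b)) 0 (suc b)
      ≡⟨ walks-lastStep (k * n + b) W 0 b ⟩
    paths W 0 b n + walks W (k * n + b) 0 (b + k)
      ≡⟨ cong (paths W 0 b n +_) (lastDown n) ⟩
    paths W 0 b n + shiftS 1 (paths W 0 (b + k)) n ∎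
    where
    lastDown : ∀ n → walks W (k * n + b) 0 (b + k) ≡ shiftS 1 (paths W 0 (b + k)) n
    lastDown zero    = walks-unreachable (k * 0 + b) W 0 (b + k)
      (subst (_< b + k) (cong (_+ b) (sym (*-zeroʳ k))) (m<m+n b (>-nonZero⁻¹ k)))
    lastDown (suc m) = cong (λ L → walks W L 0 (b + k))
      (trans (k*[1+n]+b≡k*n+b+k k m b) (+-assoc (k * m) b k))

  paths-lastStep-ground : ∀ W n → paths W 0 0 (suc n) ≡ paths (W ∘ suc) 0 (pred k) n
  paths-lastStep-ground W n =
    trans (cong (λ L → walks W L 0 0) length≡) (walks-lastStep-ground (k * n + pred k) W 0)
    where
    length≡ : k * suc n + 0 ≡ suc (k * n + pred k)
    length≡ = trans (+-identityʳ _) (trans (*-suc k n) (trans (cong (_+ k * n) (sym (suc-pred k)))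
                    (cong suc (+-comm (pred k) (k * n)))))

  paths-noDown : ∀ j → paths (const 1) 0 j 0 ≡ 1
  paths-noDown zero    = cong (λ L → walks (const 1) L 0 0) (cong (_+ 0) (*-zeroʳ k))
  paths-noDown (suc j) = trans (paths-lastStep (const 1) j 0) (trans (+-identityʳ _) (paths-noDown j))

module FirstReturn (k₂ : ℕ) where

  k : ℕ
  k = suc (suc k₂)

  open Walks k

  k*j+k₂<k*[1+m] : ∀ j m → j ≤ m → k * j + k₂ < k * suc m
  k*j+k₂<k*[1+m] j m j≤m = <-≤-trans (+-monoʳ-< (k * j) (m<n⇒m<1+n (n<1+n k₂)))
    (≤-trans (≤-reflexive (trans (+-comm (k * j) k) (sym (*-suc k j)))) (*-monoʳ-≤ k (s≤s j≤m)))

  notUpFirst : ℕ → Series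
  notUpFirst h j = firstDown (const 1) h k₂ j + emptyPath (const 1) h k₂ j

  -- F bounds the distance k * n + b ∸ h still to be climbed, which decreases along the first step.
  paths-firstReturn : ∀ F W h b n → k * n + b ≤ h + F →
    paths W (suc h) b n
      ≡ W 0 * paths (exactly 0) (suc h) b n + shiftS 1 (paths (const 1) h k₂ ⊛ paths (W ∘ suc) 0 b) n
  firstDown-firstReturn : ∀ F W h b n → k * n + b ≤ h + suc F →
    firstDown W (suc h) b n
      ≡ W 0 * firstDown (exactly 0) (suc h) b n
        + shiftS 1 (notUpFirst h ⊛ paths (W ∘ suc) 0 b) n

  paths-firstReturn zero W h b n kn+b≤h+0 = begin
    paths W (suc h) b n
      ≡⟨ paths-vanish W (suc h) b n (s≤s kn+b≤h) ⟩
    0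
      ≡⟨ cong₂ _+_ (trans (cong (W 0 *_) (paths-vanish (exactly 0) (suc h) b n (s≤s kn+b≤h))) (*-zeroʳ (W 0)))
                   (noReturnYet n kn+b≤h) ⟨
    W 0 * paths (exactly 0) (suc h) b n + shiftS 1 (paths (const 1) h k₂ ⊛ paths (W ∘ suc) 0 b) n ∎
    where
    kn+b≤h : k * n + b ≤ h
    kn+b≤h = subst (k * n + b ≤_) (+-identityʳ h) kn+b≤h+0
    noReturnYet : ∀ n → k * n + b ≤ h → shiftS 1 (paths (const 1) h k₂ ⊛ paths (W ∘ suc) 0 b) n ≡ 0
    noReturnYet zero    _           = refl
    noReturnYet (suc m) k[1+m]+b≤h = sumTo-zero m λ j j≤m →
      cong (_* paths (W ∘ suc) 0 b (m ∸ j)) (paths-vanish (const 1) h k₂ j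
        (<-≤-trans (k*j+k₂<k*[1+m] j m j≤m) (≤-trans (m≤m+n (k * suc m) b) k[1+m]+b≤h)))
  paths-firstReturn (suc F) W h b n kn+b≤h+1+F = begin
    paths W (suc h) b n
      ≡⟨ paths-firstStep W (suc h) b n ⟩
    paths W (suc (suc h)) b n + firstDown W (suc h) b n + emptyPath W (suc h) b n
      ≡⟨ cong₂ _+_ (cong₂ _+_ (paths-firstReturn F W (suc h) b n (subst (k * n + b ≤_) (+-suc h F) kn+b≤h+1+F))
                              (firstDown-firstReturn F W h b n kn+b≤h+1+F))
                   (emptyPath-weight W (suc h) b n) ⟩
    W 0 * Z₂ + S₂ + (W 0 * D₀ + Sᵣ) + W 0 * E₀
      ≡⟨ regroup (W 0) Z₂ S₂ D₀ Sᵣ E₀ ⟩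
    W 0 * (Z₂ + D₀ + E₀) + (S₂ + Sᵣ)
      ≡⟨ cong₂ (λ x y → W 0 * x + y) (paths-firstStep (exactly 0) (suc h) b n) shifted ⟨
    W 0 * paths (exactly 0) (suc h) b n + shiftS 1 (paths (const 1) h k₂ ⊛ Rest) n ∎
    where
    Rest : Series
    Rest = paths (W ∘ suc) 0 b
    Z₂ D₀ E₀ S₂ Sᵣ : ℕ
    Z₂ = paths (exactly 0) (suc (suc h)) b n
    D₀ = firstDown (exactly 0) (suc h) b n
    E₀ = emptyPath (exactly 0) (suc h) b n
    S₂ = shiftS 1 (paths (const 1) (suc h) k₂ ⊛ Rest) n
    Sᵣ = shiftS 1 (notUpFirst h ⊛ Rest) n
    regroup : ∀ w z s d r e → w * z + s + (w * d + r) + w * e ≡ w * (z + d + e) + (s + r)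
    regroup = solve-∀
    split : paths (const 1) h k₂ ⊛ Rest ≗ λ m → (paths (const 1) (suc h) k₂ ⊛ Rest) m + (notUpFirst h ⊛ Rest) m
    split m = trans (⊛-congˡ Rest (λ j → trans (paths-firstStep (const 1) h k₂ j)
                                              (+-assoc (paths (const 1) (suc h) k₂ j) _ _)) m)
                    (⊛-distribʳ-+ (paths (const 1) (suc h) k₂) (notUpFirst h) Rest m)
    shifted : shiftS 1 (paths (const 1) h k₂ ⊛ Rest) n ≡ S₂ + Sᵣ
    shifted = trans (shiftS-cong 1 split n) (shiftS1-+ (paths (const 1) (suc h) k₂ ⊛ Rest) (notUpFirst h ⊛ Rest) n)

  firstDown-firstReturn F W h b zero    _ = sym (trans (+-identityʳ _) (*-zeroʳ (W 0)))
  firstDown-firstReturn F W h b (suc m) k[1+m]+b≤h+1+F = byLanding (downFrom (suc h))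
    where
    Rest : Series
    Rest = paths (W ∘ suc) 0 b
    byLanding : DownFrom (suc h) →
      firstDown W (suc h) b (suc m) ≡ W 0 * firstDown (exactly 0) (suc h) b (suc m) + (notUpFirst h ⊛ Rest) m
    byLanding (blocked 2+h<k) = begin
      firstDown W (suc h) b (suc m)
        ≡⟨ firstDown-blocked W (suc h) b (suc m) 2+h<k ⟩
      0
        ≡⟨ trans (cong₂ (λ x y → W 0 * x + y) (firstDown-blocked (exactly 0) (suc h) b (suc m) 2+h<k)
                                             (sumTo-zero m λ j _ → cong (_* Rest (m ∸ j)) (notUpFirst≗0 j)))
                 (trans (+-identityʳ _) (*-zeroʳ (W 0))) ⟨
      W 0 * firstDown (exactly 0) (suc h) b (suc m) + (notUpFirst h ⊛ Rest) m ∎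
      where
      h<k₂ : h < k₂
      h<k₂ = s≤s⁻¹ (s≤s⁻¹ 2+h<k)
      notUpFirst≗0 : notUpFirst h ≗ const 0
      notUpFirst≗0 j = cong₂ _+_ (firstDown-blocked (const 1) h k₂ j (<-trans (n<1+n (suc h)) 2+h<k))
                        (emptyPath-vanish (const 1) h k₂ j (<-≤-trans h<k₂ (m≤n+m k₂ (k * j))))
    byLanding (returns 2+h≡k) = begin
      firstDown W (suc h) b (suc m)
        ≡⟨ downStep-returns W (suc h) (pathsTo b m) 2+h≡k (pathsTo-invariant b m 0) ⟩
      Rest m
        ≡⟨ ⊛-identityˡ Rest m ⟨
      (oneS ⊛ Rest) m
        ≡⟨ ⊛-congˡ Rest notUpFirst≗oneS m ⟨
      (notUpFirst h ⊛ Rest) m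
        ≡⟨ cong (_+ (notUpFirst h ⊛ Rest) m) (trans (cong (W 0 *_) noReturn) (*-zeroʳ (W 0))) ⟨
      W 0 * firstDown (exactly 0) (suc h) b (suc m) + (notUpFirst h ⊛ Rest) m ∎
      where
      noReturn : firstDown (exactly 0) (suc h) b (suc m) ≡ 0
      noReturn = trans (downStep-returns (exactly 0) (suc h) (pathsTo b m) 2+h≡k (pathsTo-invariant b m 0))
                       (walks-zero (k * m + b ∸ 0) 0 b (λ _ → refl))
      notUpFirst≗oneS : notUpFirst h ≗ oneS
      notUpFirst≗oneS zero    = cong (λ c → if c then 1 else 0) (≡ᵇ-true (suc-injective (suc-injective 2+h≡k)))
      notUpFirst≗oneS (suc j) = cong (_+ 0) (firstDown-blocked (const 1) h k₂ (suc j) (≤-reflexive 2+h≡k))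
    byLanding (lands e 2+h≡k+1+e) = begin
      firstDown W (suc h) b (suc m)
        ≡⟨ downStep-lands W (suc h) (pathsTo b m) e 2+h≡k+1+e (pathsTo-invariant b m (suc e)) ⟩
      paths W (suc e) b m
        ≡⟨ paths-firstReturn F W e b m km+b≤e+F ⟩
      W 0 * paths (exactly 0) (suc e) b m + shiftS 1 (paths (const 1) e k₂ ⊛ Rest) m
        ≡⟨ cong₂ (λ x y → W 0 * x + y)
                 (downStep-lands (exactly 0) (suc h) (pathsTo b m) e 2+h≡k+1+e (pathsTo-invariant b m (suc e)))
                 (trans (⊛-congˡ Rest notUpFirst≗tX m) (shiftS-⊛ˡ (paths (const 1) e k₂) Rest m)) ⟨
      W 0 * firstDown (exactly 0) (suc h) b (suc m) + (notUpFirst h ⊛ Rest) m ∎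
      where
      1+h≡k+e : suc h ≡ k + e
      1+h≡k+e = suc-injective (trans 2+h≡k+1+e (+-suc k e))
      km+b≤e+F : k * m + b ≤ e + F
      km+b≤e+F = +-cancelˡ-≤ k (k * m + b) (e + F) (subst₂ _≤_
        (trans (cong (_+ b) (*-suc k m)) (+-assoc k (k * m) b))
        (trans (cong (_+ suc F) (suc-injective 1+h≡k+e)) (shuffle k₂ e F)) k[1+m]+b≤h+1+F)
        where
        shuffle : ∀ k₂ e F → suc k₂ + e + suc F ≡ suc (suc k₂) + (e + F)
        shuffle = solve-∀
      notUpFirst≗tX : notUpFirst h ≗ shiftS 1 (paths (const 1) e k₂)
      notUpFirst≗tX zero    = cong (λ c → if c then 1 else 0) (≡ᵇ-false λ h≡k₂ →
        <⇒≢ (subst (k₂ <_) (sym (suc-injective 1+h≡k+e)) (s≤s (m≤m+n k₂ e))) (sym h≡k₂))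
      notUpFirst≗tX (suc j) = trans (+-identityʳ _) (downStep-const1 h (pathsTo k₂ j) e 1+h≡k+e)

  paths-groundStep : ∀ W b n → paths W 0 b n ≡ paths W 1 b n + emptyPath W 0 b n
  paths-groundStep W b n =
    trans (paths-firstStep W 0 b n)
          (cong (λ x → x + emptyPath W 0 b n)
                (trans (cong (paths W 1 b n +_) (firstDown-blocked W 0 b n (s≤s (s≤s z≤n)))) (+-identityʳ _)))

  nonReturning-fromGround-zero : paths (exactly 0) 0 0 ≗ oneS
  nonReturning-fromGround-zero n =
    trans (paths-groundStep (exactly 0) 0 n) (cong₂ _+_ (paths-nonReturning-ground 0 n) (empty≗oneS n))
    where
    empty≗oneS : emptyPath (exactly 0) 0 0 ≗ oneS
    empty≗oneS zero    = refl
    empty≗oneS (suc n) = refl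

  nonReturning-fromGround-suc : ∀ b → paths (exactly 0) 0 (suc b) ≗ paths (const 1) 0 b
  nonReturning-fromGround-suc b n =
    trans (paths-groundStep (exactly 0) (suc b) n)
          (trans (cong₂ _+_ (paths-nonReturning 0 b n) (empty≗0 n)) (+-identityʳ _))
    where
    empty≗0 : emptyPath (exactly 0) 0 (suc b) ≗ const 0
    empty≗0 zero    = refl
    empty≗0 (suc n) = refl

  paths-fromGround : ∀ W b n →
    paths W 0 b n ≡ W 0 * paths (exactly 0) 0 b n + shiftS 1 (paths (const 1) 0 k₂ ⊛ paths (W ∘ suc) 0 b) n
  paths-fromGround W b n = begin
    paths W 0 b n
      ≡⟨ paths-groundStep W b n ⟩
    paths W 1 b n + emptyPath W 0 b n
      ≡⟨ cong₂ _+_ (paths-firstReturn (k * n + b) W 0 b n ≤-refl) (emptyPath-weight W 0 b n) ⟩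
    W 0 * paths (exactly 0) 1 b n + S + W 0 * emptyPath (exactly 0) 0 b n
      ≡⟨ regroup (W 0) (paths (exactly 0) 1 b n) S (emptyPath (exactly 0) 0 b n) ⟩
    W 0 * (paths (exactly 0) 1 b n + emptyPath (exactly 0) 0 b n) + S
      ≡⟨ cong (λ x → W 0 * x + S) (paths-groundStep (exactly 0) b n) ⟨
    W 0 * paths (exactly 0) 0 b n + S ∎
    where
    S : ℕ
    S = shiftS 1 (paths (const 1) 0 k₂ ⊛ paths (W ∘ suc) 0 b) n
    regroup : ∀ w p s e → w * p + s + w * e ≡ w * (p + e) + s
    regroup = solve-∀

  Cₖ : Series
  Cₖ = paths (const 1) 0 0

  paths-fromGround-fixpoint : ∀ b →
    paths (const 1) 0 b ≗ λ n → paths (exactly 0) 0 b n + shiftS 1 (paths (const 1) 0 k₂ ⊛ paths (const 1) 0 b) n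
  paths-fromGround-fixpoint b n = trans (paths-fromGround (const 1) b n)
    (cong (_+ shiftS 1 (paths (const 1) 0 k₂ ⊛ paths (const 1) 0 b) n) (+-identityʳ (paths (exactly 0) 0 b n)))

  Cₖ-fixpoint : Cₖ ≗ λ n → oneS n + shiftS 1 (paths (const 1) 0 k₂ ⊛ Cₖ) n
  Cₖ-fixpoint n = trans (paths-fromGround-fixpoint 0 n)
    (cong (_+ shiftS 1 (paths (const 1) 0 k₂ ⊛ Cₖ) n) (nonReturning-fromGround-zero n))

  -- Both sides solve A = B + t (C_{(0,k-2)} ⊛ A) with B the walks from the ground that never return.
  paths-lastReturn : ∀ b → paths (const 1) 0 b ≗ Cₖ ⊛ paths (exactly 0) 0 b
  paths-lastReturn b = shift-fixpoint-unique (paths (exactly 0) 0 b) (paths (const 1) 0 k₂) _ _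
    (paths-fromGround-fixpoint b) (⊛-fixpoint (paths (const 1) 0 k₂) Cₖ (paths (exactly 0) 0 b) Cₖ-fixpoint)

  nonReturning-power : ∀ b → paths (exactly 0) 0 b ≗ powS Cₖ b
  paths-power : ∀ b → paths (const 1) 0 b ≗ powS Cₖ (suc b)

  nonReturning-power zero    n = nonReturning-fromGround-zero n
  nonReturning-power (suc b) n = trans (nonReturning-fromGround-suc b n) (paths-power b n)

  paths-power b n = trans (paths-lastReturn b n) (⊛-congʳ Cₖ (nonReturning-power b) n)

  paths-returns-fromGround : ∀ r β → paths (exactly r) 0 β ≗ shiftS r (powS Cₖ (β + r * suc k₂))
  paths-returns-fromGround zero    β n =
    trans (nonReturning-power β n) (cong (λ e → powS Cₖ e n) (sym (+-identityʳ β)))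
  paths-returns-fromGround (suc r) β n = begin
    paths (exactly (suc r)) 0 β n
      ≡⟨ paths-fromGround (exactly (suc r)) β n ⟩
    shiftS 1 (paths (const 1) 0 k₂ ⊛ paths (exactly r) 0 β) n
      ≡⟨ shiftS-cong 1 (λ m → trans (⊛-congʳ (paths (const 1) 0 k₂) (paths-returns-fromGround r β) m)
                                    (⊛-shiftSʳ r (paths (const 1) 0 k₂) P m)) n ⟩
    shiftS 1 (shiftS r (paths (const 1) 0 k₂ ⊛ P)) n
      ≡⟨ shiftS-suc r (paths (const 1) 0 k₂ ⊛ P) n ⟨
    shiftS (suc r) (paths (const 1) 0 k₂ ⊛ P) n
      ≡⟨ shiftS-cong (suc r) (λ m → trans (⊛-congˡ P (paths-power k₂) m)
                                          (powS-+ (suc k₂) (β + r * suc k₂) Cₖ m)) n ⟩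
    shiftS (suc r) (powS Cₖ (suc k₂ + (β + r * suc k₂))) n
      ≡⟨ cong (λ e → shiftS (suc r) (powS Cₖ e) n) (shuffle k₂ β r) ⟩
    shiftS (suc r) (powS Cₖ (β + suc r * suc k₂)) n ∎
    where
    P : Series
    P = powS Cₖ (β + r * suc k₂)
    shuffle : ∀ k₂ β r → suc k₂ + (β + r * suc k₂) ≡ β + suc r * suc k₂
    shuffle = solve-∀

  [k-1]*[kn+k-1]Cn≡[kn+k-1]C[1+n] : ∀ n → suc k₂ * ((k * n + suc k₂) C n) ≡ (k * n + suc k₂) C suc n
  [k-1]*[kn+k-1]Cn≡[kn+k-1]C[1+n] n = *-cancelˡ-≡ _ _ (suc n) (begin
    suc n * (suc k₂ * (Q C n))      ≡⟨ swap (suc n) (suc k₂) (Q C n) ⟩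
    suc k₂ * suc n * (Q C n)        ≡⟨ cong (λ P → suc k₂ * suc n * (P C n)) n+e≡Q ⟨
    suc k₂ * suc n * (N C n)        ≡⟨ [1+m]*[m+e]C[1+m]≡e*[m+e]Cm n (suc k₂ * suc n) ⟨
    suc n * (N C suc n)             ≡⟨ cong (λ P → suc n * (P C suc n)) n+e≡Q ⟩
    suc n * (Q C suc n)             ∎)
    where
    Q N : ℕ
    Q = k * n + suc k₂
    N = n + suc k₂ * suc n
    swap : ∀ a b c → a * (b * c) ≡ b * a * c
    swap = solve-∀
    n+e≡Q : N ≡ Q
    n+e≡Q = solve k₂ n
      where solve : ∀ k₂ n → n + suc k₂ * suc n ≡ suc (suc k₂) * n + suc k₂
            solve = solve-∀

  k[1+n]+0≡1+kn+[k-1] : ∀ n → k * suc n + 0 ≡ suc (k * n + suc k₂)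
  k[1+n]+0≡1+kn+[k-1] n = solve k₂ n
    where
    solve : ∀ k₂ n → suc (suc k₂) * suc n + 0 ≡ suc (suc (suc k₂) * n + suc k₂)
    solve = solve-∀

  kn+[j+k]≡k[1+n]+j : ∀ n j → k * n + (j + k) ≡ k * suc n + j
  kn+[j+k]≡k[1+n]+j n j = solve k₂ n j
    where
    solve : ∀ k₂ n j → suc (suc k₂) * n + (j + suc (suc k₂)) ≡ suc (suc k₂) * suc n + j
    solve = solve-∀

  Ballot : ℕ → ℕ → ℕ → Set
  Ballot n j P = paths (const 1) 0 j n + suc k₂ * (P C⁻ n) ≡ P C n

  ballot : ∀ n j P → k * n + j ≡ P → Ballot n j P
  ballot zero    j       P _ = cong₂ _+_ (paths-noDown j) (*-zeroʳ (suc k₂))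
  ballot (suc n) zero    P k[1+n]+0≡P =
    subst (Ballot (suc n) 0) (trans (sym (k[1+n]+0≡1+kn+[k-1] n)) k[1+n]+0≡P) (begin
    paths (const 1) 0 0 (suc n) + suc k₂ * (suc Q C n)
      ≡⟨ cong₂ _+_ (paths-lastStep-ground (const 1) n) (cong (suc k₂ *_) ([1+P]Cn≡PC⁻n+PCn Q n)) ⟩
    paths (const 1) 0 (suc k₂) n + suc k₂ * (Q C⁻ n + Q C n)
      ≡⟨ regroup (paths (const 1) 0 (suc k₂) n) (suc k₂) (Q C⁻ n) (Q C n) ⟩
    paths (const 1) 0 (suc k₂) n + suc k₂ * (Q C⁻ n) + suc k₂ * (Q C n)
      ≡⟨ cong₂ _+_ (ballot n (suc k₂) Q refl) ([k-1]*[kn+k-1]Cn≡[kn+k-1]C[1+n] n) ⟩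
    Q C n + Q C suc n
      ≡⟨ nCk+nC[k+1]≡[n+1]C[k+1] Q n ⟩
    suc Q C suc n ∎)
    where
    Q : ℕ
    Q = k * n + suc k₂
    regroup : ∀ p c a q → p + c * (a + q) ≡ p + c * a + c * q
    regroup = solve-∀
  ballot (suc n) (suc j) P k[1+n]+1+j≡P =
    subst (Ballot (suc n) (suc j)) (trans (sym (+-suc (k * suc n) j)) k[1+n]+1+j≡P) (begin
    paths (const 1) 0 (suc j) (suc n) + suc k₂ * (suc R C n)
      ≡⟨ cong₂ _+_ (paths-lastStep (const 1) j (suc n)) (cong (suc k₂ *_) ([1+P]Cn≡PC⁻n+PCn R n)) ⟩
    paths (const 1) 0 j (suc n) + paths (const 1) 0 (j + k) n + suc k₂ * (R C⁻ n + R C n)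
      ≡⟨ regroup (paths (const 1) 0 j (suc n)) (paths (const 1) 0 (j + k) n) (suc k₂) (R C⁻ n) (R C n) ⟩
    (paths (const 1) 0 j (suc n) + suc k₂ * (R C n)) + (paths (const 1) 0 (j + k) n + suc k₂ * (R C⁻ n))
      ≡⟨ cong₂ _+_ (ballot (suc n) j R refl) (ballot n (j + k) R (kn+[j+k]≡k[1+n]+j n j)) ⟩
    R C suc n + R C n
      ≡⟨ +-comm (R C suc n) (R C n) ⟩
    R C n + R C suc n
      ≡⟨ nCk+nC[k+1]≡[n+1]C[k+1] R n ⟩
    suc R C suc n ∎)
    where
    R : ℕ
    R = k * suc n + j
    regroup : ∀ p p′ c a q → p + p′ + c * (a + q) ≡ (p + c * q) + (p′ + c * a)
    regroup = solve-∀

  catalan≗Cₖ : catalan k ≗ Cₖ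
  catalan≗Cₖ n = trans (cong (_/ suc (k * n)) (binomial≡ n)) (m*n/n≡m (Cₖ n) (suc (k * n)))
    where
    binomial≡ : ∀ n → suc (k * n) C n ≡ Cₖ n * suc (k * n)
    binomial≡ zero    =
      sym (trans (cong (_* suc (k * 0)) (paths-noDown 0)) (trans (+-identityʳ _) (cong suc (*-zeroʳ k))))
    binomial≡ (suc m) = sym (+-cancelʳ-≡ (κ * c * suc P) (Cₖ (suc m) * suc P) (suc P C suc m) (begin
      Cₖ (suc m) * suc P + κ * c * suc P      ≡⟨ *-distribʳ-+ (suc P) (Cₖ (suc m)) (κ * c) ⟨
      (Cₖ (suc m) + κ * c) * suc P            ≡⟨ cong (_* suc P) (ballot (suc m) 0 P (+-identityʳ P)) ⟩
      a * suc P                               ≡⟨ expand k₂ m a ⟩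
      a + k * (suc m * a)                     ≡⟨ cong (λ x → a + k * x) absorption ⟩
      a + k * (suc (κ * suc m) * c)           ≡⟨ collect k₂ m a c ⟩
      c + a + κ * c * suc P                   ≡⟨ cong (_+ κ * c * suc P) (nCk+nC[k+1]≡[n+1]C[k+1] P m) ⟩
      suc P C suc m + κ * c * suc P           ∎))
      where
      κ P a c : ℕ
      κ = suc k₂
      P = k * suc m
      a = P C suc m
      c = P C m
      absorption : suc m * a ≡ suc (κ * suc m) * c
      absorption = subst (λ Q → suc m * (Q C suc m) ≡ suc (κ * suc m) * (Q C m)) (m+e≡P k₂ m)
                         ([1+m]*[m+e]C[1+m]≡e*[m+e]Cm m (suc (κ * suc m)))
        where
        m+e≡P : ∀ k₂ m → m + suc (suc k₂ * suc m) ≡ suc (suc k₂) * suc m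
        m+e≡P = solve-∀
      expand : ∀ k₂ m a → a * suc (suc (suc k₂) * suc m) ≡ a + suc (suc k₂) * (suc m * a)
      expand = solve-∀
      collect : ∀ k₂ m a c → a + suc (suc k₂) * (suc (suc k₂ * suc m) * c)
                               ≡ c + a + suc k₂ * c * suc (suc (suc k₂) * suc m)
      collect = solve-∀

  Cret-noReturns : ∀ a β n → Cret k n (suc a) β 0 ≡ CGF k (ℤ.+ a) (ℤ.+ β ℤ.- ℤ.+ 1) n
  Cret-noReturns a zero    n = trans (Cret≡paths n (suc a) 0 0) (paths-nonReturning-ground a n)
  Cret-noReturns a (suc b) n =
    trans (Cret≡paths n (suc a) (suc b) 0) (trans (paths-nonReturning a b n) (sym (Cnat≡paths n a b)))

  Cret-returns : ∀ a β i n →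
    Cret k n (suc a) β (suc i) ≡ shiftS (suc i) (CGF k (ℤ.+ a) (ℤ.+ k₂) ⊛ powS (catalan k) (β + i * suc k₂)) n
  Cret-returns a β i n = begin
    Cret k n (suc a) β (suc i)
      ≡⟨ Cret≡paths n (suc a) β (suc i) ⟩
    paths (exactly (suc i)) (suc a) β n
      ≡⟨ paths-firstReturn (k * n + β) (exactly (suc i)) a β n (m≤n+m (k * n + β) a) ⟩
    shiftS 1 (paths (const 1) a k₂ ⊛ paths (exactly i) 0 β) n
      ≡⟨ shiftS-cong 1 (λ m → trans (⊛-congʳ (paths (const 1) a k₂) (paths-returns-fromGround i β) m)
                                    (⊛-shiftSʳ i (paths (const 1) a k₂) (powS Cₖ (β + i * suc k₂)) m)) n ⟩
    shiftS 1 (shiftS i (paths (const 1) a k₂ ⊛ powS Cₖ (β + i * suc k₂))) n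
      ≡⟨ shiftS-suc i (paths (const 1) a k₂ ⊛ powS Cₖ (β + i * suc k₂)) n ⟨
    shiftS (suc i) (paths (const 1) a k₂ ⊛ powS Cₖ (β + i * suc k₂)) n
      ≡⟨ shiftS-cong (suc i) (λ m → trans (⊛-congˡ (powS Cₖ (β + i * suc k₂)) (λ j → sym (Cnat≡paths j a k₂)) m)
                                          (⊛-congʳ (CGF k (ℤ.+ a) (ℤ.+ k₂))
                                                   (powS-cong (β + i * suc k₂) (λ j → sym (catalan≗Cₖ j))) m)) n ⟩
    shiftS (suc i) (CGF k (ℤ.+ a) (ℤ.+ k₂) ⊛ powS (catalan k) (β + i * suc k₂)) n ∎

-- Imported only here: ℤ's prefix +_ would make the sections (x +_) above ambiguous.
open import Data.Integer using (+_; _-_)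

proposition3p9 : (k α β : ℕ) → 2 ≤ k → 0 < α → (n : ℕ) →
    (Cret k n α β 0 ≡ CGF k (+ α - + 1) (+ β - + 1) n)
    × ((i : ℕ) → 1 ≤ i →
        Cret k n α β i
          ≡ shiftS i (CGF k (+ α - + 1) (+ k - + 2) ⊛ powS (catalan k) (β + (i ∸ 1) * (k ∸ 1))) n)
proposition3p9 (suc (suc k₂)) (suc a) β (s≤s (s≤s z≤n)) (s≤s z≤n) n =
  Cret-noReturns a β n , λ { (suc i) _ → Cret-returns a β i n }
  where open FirstReturn k₂
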